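{- Let $s\ge1$ and let $(c,a_1,\dots,a_s)$ be positive integers with $\gcd(c,a_1,\dots,a_s)=1$, and $a_i\mid c$ and $a_i<c$ for all $i\in\{1,\dots,s\}$. Then there is a unique $p\ge1$ such that there exists a smooth arithmetical structure $(\mathbf{d},\mathbf{r})$ on $\mathcal{CT}(p,s)$ with $r_{\ell_i}=a_i$ for all $i\in\{1,\dots,s\}$ and $r_p=c$. Moreover, this arithmetical structure $(\mathbf{d},\mathbf{r})$ is unique.
   Context: The coconut tree $\mathcal{CT}(p,s)$ is the graph with vertices $v_1,\dots,v_p,v_{\ell_1},\dots,v_{\ell_s}$ and edges $v_iv_{i+1}$ ($1\le i\le p-1$) and $v_pv_{\ell_j}$ ($1\le j\le s$). An arithmetical structure on a finite connected simple graph is a pair $(\mathbf{d},\mathbf{r})$ of vectors of positive integers indexed by the vertices such that for every vertex $v$, $d_vr_v$ equals the sum of $r_u$ over the neighbors $u$ of $v$, and the entries of $\mathbf{r}$ have gcd $1$. On $\mathcal{CT}(p,s)$ write $\mathbf{r}=(r_1,\dots,r_p,r_{\ell_1},\dots,r_{\ell_s})$ and $\mathbf{d}=(d_1,\dots,d_p,d_{\ell_1},\dots,d_{\ell_s})$. The structure is smooth if $d_1,\dots,d_{p-1},d_{\ell_1},\dots,d_{\ell_s}\ge2$. -}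

module Defs where

open import Data.Nat using (ℕ; zero; suc; _+_; _*_; _∸_; _≤_; _<_; _≟_; _<?_)
open import Data.Nat.GCD using (gcd)
open import Data.Fin using (Fin; toℕ)
open import Data.List using (List; map; foldr; allFin)
open import Data.Nat.ListAction using (sum)
open import Data.Bool using (Bool; true; false; _∧_; _∨_; if_then_else_)
open import Relation.Nullary.Decidable using (⌊_⌋)
open import Relation.Binary.PropositionalEquality using (_≡_)

gcdList : List ℕ → ℕ
gcdList = foldr gcd 0

-- A finite simple graph on vertex set Fin n, given by a (symmetric, irreflexive)
-- Boolean adjacency function.
Graph : ℕ → Set
Graph n = Fin n → Fin n → Bool

neighbourSum : {n : ℕ} → Graph n → (Fin n → ℕ) → Fin n → ℕ
neighbourSum {n} G f v = sum (map (λ u → if G v u then f u else 0) (allFin n))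

record IsArithmetical {n : ℕ} (G : Graph n) (d r : Fin n → ℕ) : Set where
  field
    d-pos   : ∀ v → 1 ≤ d v
    r-pos   : ∀ v → 1 ≤ r v
    balance : ∀ v → d v * r v ≡ neighbourSum G r v
    r-gcd   : gcdList (map r (allFin n)) ≡ 1

-- Coconut tree CT(p,s) on vertex set Fin (p + s):
-- vertex with index k < p is v_{k+1} (so v_p has index p ∸ 1),
-- vertex with index p + j is the leaf ℓ_{j+1}.
-- Edges: v_i v_{i+1} (1 ≤ i ≤ p-1) and v_p ℓ_j.
ctAdjℕ : ℕ → ℕ → ℕ → Bool
ctAdjℕ p i j =
     (⌊ i <? p ⌋ ∧ ⌊ j <? p ⌋ ∧ (⌊ suc i ≟ j ⌋ ∨ ⌊ suc j ≟ i ⌋))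
  ∨ (⌊ i ≟ p ∸ 1 ⌋ ∧ ⌊ p ≤? j ⌋)
  ∨ (⌊ j ≟ p ∸ 1 ⌋ ∧ ⌊ p ≤? i ⌋)
  where open import Data.Nat using (_≤?_)

coconutTree : (p s : ℕ) → Graph (p + s)
coconutTree p s u v = ctAdjℕ p (toℕ u) (toℕ v)

IsSmooth : (p s : ℕ) → (Fin (p + s) → ℕ) → Set
IsSmooth p s d = ∀ v → ¬ (toℕ v ≡ p ∸ 1) → 2 ≤ d v
  where open import Relation.Nullary using (¬_)

GoodStructure : (s c : ℕ) (a : Fin s → ℕ) (p : ℕ) (d r : Fin (p + s) → ℕ) → Set
GoodStructure s c a p d r =
    IsArithmetical (coconutTree p s) d r
  × IsSmooth p s d
  × (∀ (i : Fin s) → r (p ↑ʳ i) ≡ a i)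
  × (∀ v → toℕ v ≡ p ∸ 1 → r v ≡ c)
  where
    open import Data.Product using (_×_)
    open import Data.Fin using (_↑ʳ_)

{-# OPTIONS --safe #-}
-- Write r_k for the label of v_k and put r_0 = 0, r_{p+1} = a_1 + ⋯ + a_s (what the leaves
-- contribute at v_p). Along the path the balance condition becomes d_k r_k = r_{k-1} + r_{k+1}
-- for 1 ≤ k ≤ p, and smoothness (d_k ≥ 2 for k < p) forces 0 = r_0 < r_1 < ⋯ < r_p = c. Hence
-- r_{k-1} is the residue of -r_{k+1} modulo r_k: read downwards from (r_{p+1}, r_p) = (Σ aᵢ, c),
-- every label is determined by a Euclid-like descent, which strictly decreases until it hits 0,
-- and p + 1 has to be the index where it first does. Conversely, the descent stopped at its
-- first zero is a smooth arithmetical structure: divisibility along the path holds by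
-- construction, at a leaf d = c / aᵢ ≥ 2, and a common divisor of all labels divides c and
-- every aᵢ, hence gcd(c, a₁, …, a_s) = 1.

module Submission where

open import Defs
open import Data.Bool using (true; false; _∨_; if_then_else_)
open import Data.Bool.Properties using (∧-zeroʳ; ∧-identityʳ; ∨-identityʳ)
open import Data.Fin using (Fin; toℕ; fromℕ; fromℕ<; _↑ˡ_; _↑ʳ_; splitAt) renaming (zero to fzero; suc to fsuc)
open import Data.Fin.Properties using (toℕ-↑ˡ; toℕ-↑ʳ; toℕ-fromℕ; toℕ-fromℕ<; toℕ<n; splitAt-↑ˡ; splitAt-↑ʳ)
open import Data.List using ([]; _∷_; map; tabulate; allFin; applyUpTo)
open import Data.List.Properties using (map-cong; tabulate-cong; map-tabulate)
open import Data.List.Relation.Unary.All as All using (All; []; _∷_)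
open import Data.List.Relation.Unary.All.Properties using (map⁺; map⁻; tabulate⁺; tabulate⁻)
open import Data.Nat
open import Data.Nat.DivMod using (m%n<n; %-distribˡ-+; m%n%n≡m%n; n%n≡0)
open import Data.Nat.Divisibility
open import Data.Nat.GCD using (gcd[m,n]∣m; gcd[m,n]∣n; gcd-greatest)
open import Data.Nat.ListAction using (sum)
open import Data.Nat.Properties
open import Algebra.Properties.CommutativeSemigroup +-commutativeSemigroup using (interchange; xy∙z≈xz∙y)
open import Data.Product using (Σ; ∃; ∃₂; _×_; _,_)
open import Data.Sum using ([_,_]′; inj₁; inj₂)
open import Function using (_∘_; id)
open import Relation.Binary using (tri<; tri≈; tri>)
open import Relation.Binary.PropositionalEquality
open import Relation.Nullary using (Dec; yes; no; ¬_; contradiction)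
open import Relation.Nullary.Decidable using (⌊_⌋; isYes≗does; dec-true; dec-false)

-- Least residues and first zeros

negMod : ℕ → ℕ → ℕ
negMod y zero        = 0
negMod y x@(suc _)   = (x ∸ y % x) % x

negMod-< : ∀ y {x} → 0 < x → negMod y x < x
negMod-< y {x@(suc _)} _ = m%n<n (x ∸ y % x) x

negMod-∣ : ∀ y {x} → 0 < x → x ∣ negMod y x + y
negMod-∣ y {x@(suc _)} _ = m%n≡0⇒n∣m _ x (begin
  ((x ∸ t) % x + y) % x        ≡⟨ %-distribˡ-+ ((x ∸ t) % x) y x ⟩
  ((x ∸ t) % x % x + t) % x    ≡⟨ cong (λ w → (w + t) % x) (m%n%n≡m%n (x ∸ t) x) ⟩
  ((x ∸ t) % x + t) % x        ≡⟨ cong (λ w → ((x ∸ t) % x + w) % x) (sym (m%n%n≡m%n y x)) ⟩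
  ((x ∸ t) % x + t % x) % x    ≡⟨ sym (%-distribˡ-+ (x ∸ t) t x) ⟩
  (x ∸ t + t) % x              ≡⟨ cong (_% x) (m∸n+n≡m (<⇒≤ (m%n<n y x))) ⟩
  x % x                        ≡⟨ n%n≡0 x ⟩
  0                            ∎)
  where
  open ≡-Reasoning
  t = y % x

residue-unique-≤ : ∀ {x y z₁ z₂} → z₁ ≤ z₂ → z₂ < x → x ∣ z₁ + y → x ∣ z₂ + y → z₁ ≡ z₂
residue-unique-≤ {x} {y} {z₁} z₁≤z₂ z₂<x x∣z₁+y x∣z₂+y with m≤n⇒∃[o]m+o≡n z₁≤z₂
... | zero  , refl = sym (+-identityʳ z₁)
... | suc δ , refl = contradiction x∣1+δ (>⇒∤ (≤-<-trans (m≤n+m (suc δ) z₁) z₂<x))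
  where
  x∣1+δ : x ∣ suc δ
  x∣1+δ = ∣m+n∣m⇒∣n (subst (x ∣_) (xy∙z≈xz∙y z₁ (suc δ) y) x∣z₂+y) x∣z₁+y

residue-unique : ∀ {x y z₁ z₂} → z₁ < x → z₂ < x → x ∣ z₁ + y → x ∣ z₂ + y → z₁ ≡ z₂
residue-unique {z₁ = z₁} {z₂} z₁<x z₂<x ∣₁ ∣₂ with ≤-total z₁ z₂
... | inj₁ z₁≤z₂ = residue-unique-≤ z₁≤z₂ z₂<x ∣₁ ∣₂
... | inj₂ z₂≤z₁ = sym (residue-unique-≤ z₂≤z₁ z₁<x ∣₂ ∣₁)

negMod-unique : ∀ {x y z} → z < x → x ∣ z + y → negMod y x ≡ z
negMod-unique {x} {y} z<x x∣z+y =
  residue-unique (negMod-< y 0<x) z<x (negMod-∣ y 0<x) x∣z+y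
  where 0<x = ≤-<-trans z≤n z<x

FirstZero : (ℕ → ℕ) → ℕ → Set
FirstZero f m = f m ≡ 0 × (∀ k → k < m → 0 < f k)

firstZero-unique : ∀ {f m n} → FirstZero f m → FirstZero f n → m ≡ n
firstZero-unique {m = m} {n} (fm≡0 , f<m) (fn≡0 , f<n) with <-cmp m n
... | tri< m<n _ _ = contradiction fm≡0 (>⇒≢ (f<n m m<n))
... | tri≈ _ m≡n _ = m≡n
... | tri> _ _ n<m = contradiction fn≡0 (>⇒≢ (f<m n n<m))

firstZero-exists : ∀ f → (∀ k → 0 < f k → f (suc k) < f k) → ∃ (FirstZero f)
firstZero-exists f decreasing = below (suc (f 0)) f decreasing ≤-refl
  where
  below : ∀ n g → (∀ k → 0 < g k → g (suc k) < g k) → g 0 < n → ∃ (FirstZero g)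
  below (suc n) g decreasing g0<1+n with g 0 ≟ 0
  ... | yes g0≡0 = 0 , g0≡0 , λ _ ()
  ... | no  g0≢0 =
    let m , g[1+m]≡0 , g∘suc>0 = below n (g ∘ suc) (decreasing ∘ suc)
                                   (<-≤-trans (decreasing 0 (n≢0⇒n>0 g0≢0)) (s≤s⁻¹ g0<1+n))
    in suc m , g[1+m]≡0 , λ where
         zero    _         → n≢0⇒n>0 g0≢0
         (suc k) (s≤s k<m) → g∘suc>0 k k<m

-- Smooth chains and the descent

descent : ℕ → ℕ → ℕ → ℕ
descent y x zero          = y
descent y x (suc zero)    = x
descent y x (suc (suc j)) = negMod (descent y x j) (descent y x (suc j))

descent-decreasing : ∀ y x k → 0 < descent y x (suc k) → descent y x (suc (suc k)) < descent y x (suc k)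
descent-decreasing y x k = negMod-< (descent y x k)

-- ρ 0, …, ρ (p + 1) are the labels r_0, …, r_{p+1} of a smooth structure along the path,
-- with d_k ≥ 2 encoded as r_k < r_{k-1} + r_{k+1}.
record IsSmoothChain (p : ℕ) (ρ : ℕ → ℕ) : Set where
  field
    start    : ρ 0 ≡ 0
    positive : ∀ k → k < p → 0 < ρ (suc k)
    balanced : ∀ k → k < p → ρ (suc k) ∣ ρ k + ρ (suc (suc k))
    smooth   : ∀ k → suc k < p → ρ (suc k) < ρ k + ρ (suc (suc k))

module _ {p ρ} (chain : IsSmoothChain p ρ) where
  open IsSmoothChain chain

  chain-positive : ∀ k → 0 < k → k ≤ p → 0 < ρ k
  chain-positive (suc k) _ k<p = positive k k<p

  chain-increasing : ∀ k → k < p → ρ k < ρ (suc k)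
  chain-increasing zero    0<p   = subst (_< ρ 1) (sym start) (positive 0 0<p)
  chain-increasing (suc k) 1+k<p = +-cancelˡ-< x _ _ (begin-strict
    x + x                       ≡⟨ cong (x +_) (sym (+-identityʳ x)) ⟩
    2 * x                       ≤⟨ *-monoˡ-≤ x (quotient>1 x∣N (smooth k 1+k<p)) ⟩
    quotient x∣N * x            ≡⟨ sym (m∣n⇒n≡quotient*m x∣N) ⟩
    ρ k + ρ (suc (suc k))       <⟨ +-monoˡ-< _ (chain-increasing k k<p) ⟩
    x + ρ (suc (suc k))         ∎)
    where
    open ≤-Reasoning
    k<p = <-trans (n<1+n k) 1+k<p
    x = ρ (suc k)
    x∣N = balanced k k<p

  chain-step : ∀ k → k < p → negMod (ρ (suc (suc k))) (ρ (suc k)) ≡ ρ k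
  chain-step k k<p = negMod-unique (chain-increasing k k<p) (balanced k k<p)

  chain-descent : ∀ j k → j + k ≡ suc p → descent (ρ (suc p)) (ρ p) j ≡ ρ k
  chain-descent zero          k refl = refl
  chain-descent (suc zero)    k refl = refl
  chain-descent (suc (suc j)) k eq   = begin
    negMod (descent′ j) (descent′ (suc j))  ≡⟨ cong₂ negMod (chain-descent j (2 + k) j+2+k≡1+p)
                                                             (chain-descent (suc j) (suc k) (cong suc j+1+k≡p)) ⟩
    negMod (ρ (2 + k)) (ρ (suc k))          ≡⟨ chain-step k k<p ⟩
    ρ k                                     ∎
    where
    open ≡-Reasoning
    descent′ = descent (ρ (suc p)) (ρ p)
    j+1+k≡p : j + suc k ≡ p
    j+1+k≡p = trans (+-suc j k) (suc-injective eq)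
    j+2+k≡1+p : j + (2 + k) ≡ suc p
    j+2+k≡1+p = trans (+-suc j (suc k)) (cong suc j+1+k≡p)
    k<p : k < p
    k<p = subst (suc k ≤_) j+1+k≡p (m≤n+m (suc k) j)

  chain-reversed : ∀ k → k ≤ suc p → ρ k ≡ descent (ρ (suc p)) (ρ p) (suc p ∸ k)
  chain-reversed k k≤1+p = sym (chain-descent (suc p ∸ k) k (m∸n+n≡m k≤1+p))

  chain⇒firstZero : FirstZero (descent (ρ (suc p)) (ρ p) ∘ suc) p
  chain⇒firstZero = trans (chain-descent (suc p) 0 (cong suc (+-identityʳ p))) start , λ j j<p →
    subst (0 <_) (sym (chain-descent (suc j) (p ∸ j) (cong suc (m+[n∸m]≡n (<⇒≤ j<p)))))
      (chain-positive (p ∸ j) (m<n⇒0<n∸m j<p) (m∸n≤m p j))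

firstZero⇒chain : ∀ {y x p} → FirstZero (descent y x ∘ suc) p →
                  let ρ = λ k → descent y x (suc p ∸ k) in
                  IsSmoothChain p ρ × ρ p ≡ x × ρ (suc p) ≡ y
firstZero⇒chain {y} {x} {p} (e[1+p]≡0 , e-positive) = chain , ρ≡e 1 p refl , ρ≡e 0 (suc p) refl
  where
  e = descent y x
  ρ : ℕ → ℕ
  ρ k = e (suc p ∸ k)

  complement : ∀ {k} → k < p → (p ∸ suc k) + suc k ≡ p
  complement = m∸n+n≡m

  ρ≡e : ∀ j k → j + k ≡ suc p → ρ k ≡ e j
  ρ≡e j k eq = cong e (subst (λ n → n ∸ k ≡ j) eq (m+n∸n≡m j k))

  module Around {j k} (eq : j + suc k ≡ p) where
    j<p : j < p
    j<p = subst (j <_) eq (m<m+n j z<s)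
    ρ[k] : ρ k ≡ e (2 + j)
    ρ[k] = ρ≡e (2 + j) k (cong suc (trans (sym (+-suc j k)) eq))
    ρ[1+k] : ρ (suc k) ≡ e (suc j)
    ρ[1+k] = ρ≡e (suc j) (suc k) (cong suc eq)
    ρ[2+k] : ρ (2 + k) ≡ e j
    ρ[2+k] = ρ≡e j (2 + k) (trans (+-suc j (suc k)) (cong suc eq))

  positive′ : ∀ {j k} → j + suc k ≡ p → 0 < ρ (suc k)
  positive′ eq = subst (0 <_) (sym ρ[1+k]) (e-positive _ j<p)
    where open Around eq

  balanced′ : ∀ {j k} → j + suc k ≡ p → ρ (suc k) ∣ ρ k + ρ (2 + k)
  balanced′ {j} eq = subst₂ _∣_ (sym ρ[1+k]) (sym (cong₂ _+_ ρ[k] ρ[2+k])) (negMod-∣ (e j) (e-positive j j<p))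
    where open Around eq

  smooth′ : ∀ {j k} → j + suc k ≡ p → suc k < p → ρ (suc k) < ρ k + ρ (2 + k)
  smooth′ {zero}   refl 1+k<p = contradiction 1+k<p (<-irrefl refl)
  smooth′ {suc j} {k} eq _ = subst₂ _<_ (sym ρ[1+k]) (sym (cong₂ _+_ ρ[k] ρ[2+k]))
    (<-≤-trans (descent-decreasing y x j (e-positive j (<-trans (n<1+n j) j<p))) (m≤n+m _ _))
    where open Around {suc j} {k} eq

  chain : IsSmoothChain p ρ
  chain = record
    { start    = e[1+p]≡0
    ; positive = λ k k<p → positive′ (complement k<p)
    ; balanced = λ k k<p → balanced′ (complement k<p)
    ; smooth   = λ k 1+k<p → smooth′ (complement (<-trans (n<1+n k) 1+k<p)) 1+k<p
    }

chains-agree : ∀ {p ρ ρ′} → IsSmoothChain p ρ → IsSmoothChain p ρ′ → ρ p ≡ ρ′ p → ρ (suc p) ≡ ρ′ (suc p) →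
               ∀ k → k ≤ suc p → ρ k ≡ ρ′ k
chains-agree {p} chain chain′ ρp≡ρ′p ρ[1+p]≡ρ′[1+p] k k≤1+p =
  trans (chain-reversed chain k k≤1+p)
        (trans (cong₂ (λ y x → descent y x (suc p ∸ k)) ρ[1+p]≡ρ′[1+p] ρp≡ρ′p)
               (sym (chain-reversed chain′ k k≤1+p)))

-- Finite sums

⌊⌋-true : ∀ {A : Set} (a? : Dec A) → A → ⌊ a? ⌋ ≡ true
⌊⌋-true a? a = trans (isYes≗does a?) (dec-true a? a)

⌊⌋-false : ∀ {A : Set} (a? : Dec A) → ¬ A → ⌊ a? ⌋ ≡ false
⌊⌋-false a? ¬a = trans (isYes≗does a?) (dec-false a? ¬a)

if-yes : ∀ {A : Set} (a? : Dec A) {v : ℕ} → A → (if ⌊ a? ⌋ then v else 0) ≡ v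
if-yes a? a = cong (if_then _ else 0) (⌊⌋-true a? a)

if-no : ∀ {A : Set} (a? : Dec A) {v : ℕ} → ¬ A → (if ⌊ a? ⌋ then v else 0) ≡ 0
if-no a? ¬a = cong (if_then _ else 0) (⌊⌋-false a? ¬a)

if-∨-disjoint : ∀ {A B : Set} (a? : Dec A) (b? : Dec B) {v : ℕ} → (A → ¬ B) →
                (if ⌊ a? ⌋ ∨ ⌊ b? ⌋ then v else 0) ≡ (if ⌊ a? ⌋ then v else 0) + (if ⌊ b? ⌋ then v else 0)
if-∨-disjoint (yes a) (yes b) disjoint = contradiction b (disjoint a)
if-∨-disjoint (yes _) (no _)  _        = sym (+-identityʳ _)
if-∨-disjoint (no _)  _       _        = refl

sum-tabulate-↑ : ∀ {m n} (f : Fin (m + n) → ℕ) →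
                 sum (tabulate f) ≡ sum (tabulate (f ∘ (_↑ˡ n))) + sum (tabulate (f ∘ (m ↑ʳ_)))
sum-tabulate-↑ {zero}  f = refl
sum-tabulate-↑ {suc m} {n} f = trans (cong (f fzero +_) (sum-tabulate-↑ {m} {n} (f ∘ fsuc))) (sym (+-assoc (f fzero) _ _))

tabulate-toℕ : ∀ n (f : ℕ → ℕ) → tabulate {n = n} (f ∘ toℕ) ≡ applyUpTo f n
tabulate-toℕ zero    f = refl
tabulate-toℕ (suc n) f = cong (f 0 ∷_) (tabulate-toℕ n (f ∘ suc))

sum-applyUpTo-cong : ∀ n {f g : ℕ → ℕ} → (∀ k → k < n → f k ≡ g k) → sum (applyUpTo f n) ≡ sum (applyUpTo g n)
sum-applyUpTo-cong zero    f≡g = refl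
sum-applyUpTo-cong (suc n) f≡g = cong₂ _+_ (f≡g 0 z<s) (sum-applyUpTo-cong n (λ k k<n → f≡g (suc k) (s<s k<n)))

sum-applyUpTo-+ : ∀ n (f g : ℕ → ℕ) → sum (applyUpTo (λ k → f k + g k) n) ≡ sum (applyUpTo f n) + sum (applyUpTo g n)
sum-applyUpTo-+ zero    f g = refl
sum-applyUpTo-+ (suc n) f g =
  trans (cong (f 0 + g 0 +_) (sum-applyUpTo-+ n (f ∘ suc) (g ∘ suc))) (interchange (f 0) (g 0) _ _)

sum-applyUpTo-zero : ∀ n (f : ℕ → ℕ) → (∀ k → k < n → f k ≡ 0) → sum (applyUpTo f n) ≡ 0
sum-applyUpTo-zero n f f≡0 = trans (sum-applyUpTo-cong n f≡0) (zeros n)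
  where
  zeros : ∀ n → sum (applyUpTo (λ _ → 0) n) ≡ 0
  zeros zero    = refl
  zeros (suc n) = zeros n

sum-applyUpTo-single : ∀ n (f : ℕ → ℕ) {t} → t < n → (∀ k → k < n → k ≢ t → f k ≡ 0) →
                       sum (applyUpTo f n) ≡ f t
sum-applyUpTo-single (suc n) f {zero}  _         f≡0 =
  trans (cong (f 0 +_) (sum-applyUpTo-zero n (f ∘ suc) (λ k k<n → f≡0 (suc k) (s<s k<n) λ ()))) (+-identityʳ _)
sum-applyUpTo-single (suc n) f {suc t} (s<s t<n) f≡0 =
  cong₂ _+_ (f≡0 0 z<s λ ())
            (sum-applyUpTo-single n (f ∘ suc) t<n (λ k k<n k≢t → f≡0 (suc k) (s<s k<n) (k≢t ∘ suc-injective)))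

↑-elim : ∀ {m n} (P : Fin (m + n) → Set) → (∀ i → P (i ↑ˡ n)) → (∀ j → P (m ↑ʳ j)) → ∀ v → P v
↑-elim {zero}  P left right v        = right v
↑-elim {suc m} P left right fzero    = left fzero
↑-elim {suc m} P left right (fsuc v) = ↑-elim (P ∘ fsuc) (left ∘ fsuc) right v

∀-toℕ⇒∀-< : ∀ {n} (P : ℕ → Set) → (∀ (i : Fin n) → P (toℕ i)) → ∀ k → k < n → P k
∀-toℕ⇒∀-< P h k k<n = subst P (toℕ-fromℕ< k<n) (h (fromℕ< k<n))

pad : ∀ {n} → ℕ → (Fin n → ℕ) → ℕ → ℕ
pad         top f zero          = 0
pad {zero}  top f (suc k)       = top
pad {suc n} top f (suc zero)    = f fzero
pad {suc n} top f (suc (suc k)) = pad top (f ∘ fsuc) (suc k)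

pad-toℕ : ∀ {n} top (f : Fin n → ℕ) i → pad top f (suc (toℕ i)) ≡ f i
pad-toℕ top f fzero    = refl
pad-toℕ top f (fsuc i) = pad-toℕ top (f ∘ fsuc) i

pad-top : ∀ n top (f : Fin n → ℕ) → pad top f (suc n) ≡ top
pad-top zero    top f = refl
pad-top (suc n) top f = pad-top n top (f ∘ fsuc)

pad-agrees : ∀ {n top} {f : Fin n → ℕ} (ρ : ℕ → ℕ) → (∀ i → f i ≡ ρ (suc (toℕ i))) → top ≡ ρ (suc n) →
             ∀ k → k ≤ n → pad top f (suc k) ≡ ρ (suc k)
pad-agrees {zero}  ρ f≡ρ top≡ρ zero    _         = top≡ρ
pad-agrees {suc n} ρ f≡ρ top≡ρ zero    _         = f≡ρ fzero
pad-agrees {suc n} ρ f≡ρ top≡ρ (suc k) (s≤s k≤n) = pad-agrees (ρ ∘ suc) (f≡ρ ∘ fsuc) top≡ρ k k≤n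

-- Neighbour sums on the coconut tree

module CoconutTree (q s : ℕ) where
  p : ℕ
  p = suc q

  adj-path-path : ∀ {m k} → m < p → k < p → ctAdjℕ p m k ≡ ⌊ suc m ≟ k ⌋ ∨ ⌊ suc k ≟ m ⌋
  adj-path-path {m} {k} m<p k<p
    rewrite ⌊⌋-true (m <? p) m<p | ⌊⌋-true (k <? p) k<p
          | ⌊⌋-false (p ≤? k) (<⇒≱ k<p) | ⌊⌋-false (p ≤? m) (<⇒≱ m<p)
          | ∧-zeroʳ ⌊ m ≟ q ⌋ | ∧-zeroʳ ⌊ k ≟ q ⌋ = ∨-identityʳ _

  adj-leaf-path : ∀ {m k} → p ≤ m → k < p → ctAdjℕ p m k ≡ ⌊ k ≟ q ⌋
  adj-leaf-path {m} {k} p≤m k<p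
    rewrite ⌊⌋-false (m <? p) (≤⇒≯ p≤m) | ⌊⌋-false (p ≤? k) (<⇒≱ k<p) | ⌊⌋-true (p ≤? m) p≤m
          | ∧-zeroʳ ⌊ m ≟ q ⌋ = ∧-identityʳ _

  adj-to-leaf : ∀ m j → ctAdjℕ p m (p + j) ≡ ⌊ m ≟ q ⌋
  adj-to-leaf m j
    rewrite ⌊⌋-false (p + j <? p) (≤⇒≯ (m≤m+n p j)) | ⌊⌋-true (p ≤? p + j) (m≤m+n p j)
          | ⌊⌋-false (p + j ≟ q) (>⇒≢ (m≤m+n p j))
          | ∧-zeroʳ ⌊ m <? p ⌋ | ∧-identityʳ ⌊ m ≟ q ⌋ = ∨-identityʳ _

  leafSum : (Fin (p + s) → ℕ) → ℕ
  leafSum r = sum (tabulate (λ j → r (p ↑ʳ j)))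

  -- profile r k is the label of v_k in the paper's 1-based numbering, with r_0 = 0 and r_{p+1}
  -- the total weight of the leaves.
  profile : (Fin (p + s) → ℕ) → ℕ → ℕ
  profile r = pad (leafSum r) (λ i → r (i ↑ˡ s))

  pathWeight : (Fin (p + s) → ℕ) → ℕ → ℕ → ℕ
  pathWeight r m k = if ctAdjℕ p m k then profile r (suc k) else 0

  neighbourSum-split : ∀ r v → neighbourSum (coconutTree p s) r v ≡
    sum (applyUpTo (pathWeight r (toℕ v)) p) + (if ⌊ toℕ v ≟ q ⌋ then leafSum r else 0)
  neighbourSum-split r v = begin
    sum (map h (allFin (p + s)))                                  ≡⟨ cong sum (map-tabulate id h) ⟩
    sum (tabulate h)                                              ≡⟨ sum-tabulate-↑ {p} {s} h ⟩
    sum (tabulate (h ∘ (_↑ˡ s))) + sum (tabulate (h ∘ (p ↑ʳ_)))   ≡⟨ cong₂ _+_ onPath onLeaves ⟩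
    sum (applyUpTo (pathWeight r m) p) + (if ⌊ m ≟ q ⌋ then leafSum r else 0) ∎
    where
    open ≡-Reasoning
    m = toℕ v
    h : Fin (p + s) → ℕ
    h u = if ctAdjℕ p m (toℕ u) then r u else 0
    onPath : sum (tabulate (h ∘ (_↑ˡ s))) ≡ sum (applyUpTo (pathWeight r m) p)
    onPath = cong sum (trans
      (tabulate-cong (λ i → cong₂ (λ k x → if ctAdjℕ p m k then x else 0)
                                  (toℕ-↑ˡ i s) (sym (pad-toℕ (leafSum r) (λ i → r (i ↑ˡ s)) i))))
      (tabulate-toℕ p (pathWeight r m)))
    leaves : ∀ b → sum (tabulate (λ j → if b then r (p ↑ʳ j) else 0)) ≡ (if b then leafSum r else 0)
    leaves true  = refl
    leaves false = trans (cong sum (tabulate-toℕ s (λ _ → 0))) (sum-applyUpTo-zero s (λ _ → 0) (λ _ _ → refl))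
    onLeaves : sum (tabulate (h ∘ (p ↑ʳ_))) ≡ (if ⌊ m ≟ q ⌋ then leafSum r else 0)
    onLeaves = trans (cong sum (tabulate-cong (λ j →
      cong (if_then r (p ↑ʳ j) else 0) (trans (cong (ctAdjℕ p m) (toℕ-↑ʳ p j)) (adj-to-leaf m (toℕ j))))))
      (leaves ⌊ m ≟ q ⌋)

  module _ (r : Fin (p + s) → ℕ) where
    private
      ρ = profile r

      predecessors : ∀ m → m ≤ p → sum (applyUpTo (λ k → if ⌊ suc k ≟ m ⌋ then ρ (suc k) else 0) p) ≡ ρ m
      predecessors zero    _   = sum-applyUpTo-zero p _ (λ _ _ → refl)
      predecessors (suc m) m<p = trans
        (sum-applyUpTo-single p (λ k → if ⌊ suc k ≟ suc m ⌋ then ρ (suc k) else 0) m<p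
          (λ k _ k≢m → if-no (suc k ≟ suc m) (k≢m ∘ suc-injective)))
        (if-yes (suc m ≟ suc m) refl)

      successors : ∀ m → sum (applyUpTo (λ k → if ⌊ suc m ≟ k ⌋ then ρ (suc k) else 0) p)
                         ≡ (if ⌊ suc m <? p ⌋ then ρ (2 + m) else 0)
      successors m with suc m <? p
      ... | yes 1+m<p = trans
        (sum-applyUpTo-single p (λ k → if ⌊ suc m ≟ k ⌋ then ρ (suc k) else 0) 1+m<p
          (λ k _ k≢1+m → if-no (suc m ≟ k) (k≢1+m ∘ sym)))
        (if-yes (suc m ≟ suc m) refl)
      ... | no  1+m≮p = sum-applyUpTo-zero p (λ k → if ⌊ suc m ≟ k ⌋ then ρ (suc k) else 0)
                          (λ k k<p → if-no (suc m ≟ k) (λ { refl → 1+m≮p k<p }))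

      upperNeighbour : ∀ m → m ≤ q →
        (if ⌊ suc m <? p ⌋ then ρ (2 + m) else 0) + ρ m + (if ⌊ m ≟ q ⌋ then leafSum r else 0) ≡ ρ m + ρ (2 + m)
      upperNeighbour m m≤q with m≤n⇒m<n∨m≡n m≤q
      ... | inj₁ m<q = begin
        _                   ≡⟨ cong₂ (λ x y → x + ρ m + y) (if-yes (suc m <? p) (s≤s m<q)) (if-no (m ≟ q) (<⇒≢ m<q)) ⟩
        ρ (2 + m) + ρ m + 0 ≡⟨ +-identityʳ _ ⟩
        ρ (2 + m) + ρ m     ≡⟨ +-comm (ρ (2 + m)) (ρ m) ⟩
        ρ m + ρ (2 + m)     ∎
        where open ≡-Reasoning
      ... | inj₂ refl = begin
        _                   ≡⟨ cong₂ (λ x y → x + ρ q + y) (if-no (suc q <? p) (<-irrefl refl)) (if-yes (q ≟ q) refl) ⟩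
        ρ q + leafSum r     ≡⟨ cong (ρ q +_) (sym (pad-top p (leafSum r) (λ i → r (i ↑ˡ s)))) ⟩
        ρ q + ρ (2 + q)     ∎
        where open ≡-Reasoning

      pathVertex : ∀ m → m < p →
        sum (applyUpTo (pathWeight r m) p) + (if ⌊ m ≟ q ⌋ then leafSum r else 0) ≡ ρ m + ρ (2 + m)
      pathVertex m m<p = begin
        sum (applyUpTo (pathWeight r m) p) + leaves
          ≡⟨ cong (_+ leaves) (trans (sum-applyUpTo-cong p split) (sum-applyUpTo-+ p successor predecessor)) ⟩
        sum (applyUpTo successor p) + sum (applyUpTo predecessor p) + leaves
          ≡⟨ cong₂ (λ x y → x + y + leaves) (successors m) (predecessors m (<⇒≤ m<p)) ⟩
        (if ⌊ suc m <? p ⌋ then ρ (2 + m) else 0) + ρ m + leaves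
          ≡⟨ upperNeighbour m (s≤s⁻¹ m<p) ⟩
        ρ m + ρ (2 + m) ∎
        where
        open ≡-Reasoning
        leaves = if ⌊ m ≟ q ⌋ then leafSum r else 0
        successor predecessor : ℕ → ℕ
        successor   k = if ⌊ suc m ≟ k ⌋ then ρ (suc k) else 0
        predecessor k = if ⌊ suc k ≟ m ⌋ then ρ (suc k) else 0
        split : ∀ k → k < p → pathWeight r m k ≡ successor k + predecessor k
        split k k<p = trans (cong (if_then ρ (suc k) else 0) (adj-path-path m<p k<p))
          (if-∨-disjoint (suc m ≟ k) (suc k ≟ m) λ { refl 2+m≡m → <-irrefl (sym 2+m≡m) (m<n+m m z<s) })

      leafVertex : ∀ m → p ≤ m → sum (applyUpTo (pathWeight r m) p) + (if ⌊ m ≟ q ⌋ then leafSum r else 0) ≡ ρ p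
      leafVertex m p≤m = begin
        sum (applyUpTo (pathWeight r m) p) + (if ⌊ m ≟ q ⌋ then leafSum r else 0)
          ≡⟨ cong₂ _+_ (sum-applyUpTo-single p (pathWeight r m) ≤-refl onlyTop) (if-no (m ≟ q) (>⇒≢ p≤m)) ⟩
        pathWeight r m q + 0
          ≡⟨ +-identityʳ _ ⟩
        pathWeight r m q
          ≡⟨ trans (cong (if_then ρ p else 0) (adj-leaf-path p≤m ≤-refl)) (if-yes (q ≟ q) refl) ⟩
        ρ p ∎
        where
        open ≡-Reasoning
        onlyTop : ∀ k → k < p → k ≢ q → pathWeight r m k ≡ 0
        onlyTop k k<p k≢q = trans (cong (if_then ρ (suc k) else 0) (adj-leaf-path p≤m k<p)) (if-no (k ≟ q) k≢q)

    neighbourSum-path : ∀ i → neighbourSum (coconutTree p s) r (i ↑ˡ s) ≡ profile r (toℕ i) + profile r (2 + toℕ i)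
    neighbourSum-path i = subst (λ m → neighbourSum (coconutTree p s) r (i ↑ˡ s) ≡ ρ m + ρ (2 + m)) (toℕ-↑ˡ i s)
      (trans (neighbourSum-split r (i ↑ˡ s)) (pathVertex _ (subst (_< p) (sym (toℕ-↑ˡ i s)) (toℕ<n i))))

    neighbourSum-leaf : ∀ j → neighbourSum (coconutTree p s) r (p ↑ʳ j) ≡ profile r p
    neighbourSum-leaf j =
      trans (neighbourSum-split r (p ↑ʳ j)) (leafVertex _ (subst (p ≤_) (sym (toℕ-↑ʳ p j)) (m≤m+n p (toℕ j))))

-- Arithmetical structures

gcdList-∣ : ∀ xs → All (gcdList xs ∣_) xs
gcdList-∣ []       = []
gcdList-∣ (x ∷ xs) = gcd[m,n]∣m x _ ∷ All.map (∣-trans (gcd[m,n]∣n x _)) (gcdList-∣ xs)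

∣-gcdList : ∀ {d} xs → All (d ∣_) xs → d ∣ gcdList xs
∣-gcdList []       []            = _ ∣0
∣-gcdList (x ∷ xs) (d∣x ∷ d∣xs) = gcd-greatest d∣x (∣-gcdList xs d∣xs)

∣-gcdList-allFin : ∀ {n} (r : Fin n → ℕ) v → gcdList (map r (allFin n)) ∣ r v
∣-gcdList-allFin r = tabulate⁻ (map⁻ (gcdList-∣ (map r (allFin _))))

neighbourSum-cong : ∀ {n} (G : Graph n) {r r′ : Fin n → ℕ} → (∀ u → r u ≡ r′ u) →
                    ∀ v → neighbourSum G r v ≡ neighbourSum G r′ v
neighbourSum-cong G r≗r′ v = cong sum (map-cong (λ u → cong (if G v u then_else 0) (r≗r′ u)) (allFin _))

arithmetical-d-unique : ∀ {n} {G : Graph n} {d d′ r r′} → IsArithmetical G d r → IsArithmetical G d′ r′ →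
                        (∀ v → r′ v ≡ r v) → ∀ v → d′ v ≡ d v
arithmetical-d-unique {G = G} {d} {d′} {r} {r′} arith arith′ r′≗r v =
  *-cancelʳ-≡ (d′ v) (d v) (r v) {{>-nonZero (IsArithmetical.r-pos arith v)}} (begin
    d′ v * r v              ≡⟨ cong (d′ v *_) (sym (r′≗r v)) ⟩
    d′ v * r′ v             ≡⟨ IsArithmetical.balance arith′ v ⟩
    neighbourSum G r′ v     ≡⟨ neighbourSum-cong G r′≗r v ⟩
    neighbourSum G r v      ≡⟨ sym (IsArithmetical.balance arith v) ⟩
    d v * r v               ∎)
  where open ≡-Reasoning

module CoconutStructures {s} (c : ℕ) (a : Fin s → ℕ) (q : ℕ) where
  open CoconutTree q s

  top : Fin (p + s)
  top = fromℕ q ↑ˡ s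

  toℕ-top : toℕ top ≡ q
  toℕ-top = trans (toℕ-↑ˡ (fromℕ q) s) (toℕ-fromℕ q)

  goodStructure⇒chain : ∀ {d r} → GoodStructure s c a p d r →
                        IsSmoothChain p (profile r) × profile r p ≡ c × profile r (suc p) ≡ sum (tabulate a)
  goodStructure⇒chain {d} {r} (arith , smooth , r-leaf , r-top) = chain , ρ[p]≡c , ρ[1+p]≡S
    where
    open IsArithmetical arith
    ρ = profile r
    ρ≡r : ∀ i → ρ (suc (toℕ i)) ≡ r (i ↑ˡ s)
    ρ≡r = pad-toℕ (leafSum r) (λ i → r (i ↑ˡ s))
    ρ[p]≡c : ρ p ≡ c
    ρ[p]≡c = trans (cong (ρ ∘ suc) (sym (toℕ-fromℕ q))) (trans (ρ≡r (fromℕ q)) (r-top top toℕ-top))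
    ρ[1+p]≡S : ρ (suc p) ≡ sum (tabulate a)
    ρ[1+p]≡S = trans (pad-top p (leafSum r) (λ i → r (i ↑ˡ s))) (cong sum (tabulate-cong r-leaf))
    balanced-at : ∀ i → d (i ↑ˡ s) * ρ (suc (toℕ i)) ≡ ρ (toℕ i) + ρ (2 + toℕ i)
    balanced-at i = trans (cong (d (i ↑ˡ s) *_) (ρ≡r i)) (trans (balance (i ↑ˡ s)) (neighbourSum-path r i))
    steep-at : ∀ i → suc (toℕ i) < p → ρ (suc (toℕ i)) < ρ (toℕ i) + ρ (2 + toℕ i)
    steep-at i 1+m<p = subst₂ _<_ (sym (ρ≡r i)) (trans (*-comm (r v) (d v)) (trans (balance v) (neighbourSum-path r i)))
      (m<m*n _ _ {{>-nonZero (r-pos v)}} (smooth v (<⇒≢ (subst (_< q) (sym (toℕ-↑ˡ i s)) (s≤s⁻¹ 1+m<p)))))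
      where v = i ↑ˡ s
    chain : IsSmoothChain p ρ
    chain = record
      { start    = refl
      ; positive = ∀-toℕ⇒∀-< (λ k → 0 < ρ (suc k)) (λ i → subst (0 <_) (sym (ρ≡r i)) (r-pos (i ↑ˡ s)))
      ; balanced = ∀-toℕ⇒∀-< (λ k → ρ (suc k) ∣ ρ k + ρ (2 + k)) (λ i → divides (d (i ↑ˡ s)) (sym (balanced-at i)))
      ; smooth   = λ k 1+k<p → ∀-toℕ⇒∀-< (λ k → suc k < p → ρ (suc k) < ρ k + ρ (2 + k)) steep-at
                                          k (<-trans (n<1+n k) 1+k<p) 1+k<p
      }

  goodStructure-length : ∀ {d r} → GoodStructure s c a p d r → FirstZero (descent (sum (tabulate a)) c ∘ suc) p
  goodStructure-length good =
    let chain , ρ[p]≡c , ρ[1+p]≡S = goodStructure⇒chain good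
    in subst₂ (λ y x → FirstZero (descent y x ∘ suc) p) ρ[1+p]≡S ρ[p]≡c (chain⇒firstZero chain)

  goodStructure-profile-unique : ∀ {d r d′ r′} → GoodStructure s c a p d r → GoodStructure s c a p d′ r′ →
                                 ∀ k → k ≤ suc p → profile r′ k ≡ profile r k
  goodStructure-profile-unique good good′ =
    let chain  , ρ[p]≡c  , ρ[1+p]≡S  = goodStructure⇒chain good
        chain′ , ρ′[p]≡c , ρ′[1+p]≡S = goodStructure⇒chain good′
    in chains-agree chain′ chain (trans ρ′[p]≡c (sym ρ[p]≡c)) (trans ρ′[1+p]≡S (sym ρ[1+p]≡S))

  goodStructure-unique : ∀ {d r d′ r′} → GoodStructure s c a p d r → GoodStructure s c a p d′ r′ →
                         ∀ v → d′ v ≡ d v × r′ v ≡ r v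
  goodStructure-unique {d} {r} {d′} {r′} good@(arith , _ , r-leaf , _) good′@(arith′ , _ , r′-leaf , _) v =
    arithmetical-d-unique arith arith′ r′≗r v , r′≗r v
    where
    onPath : ∀ i → r′ (i ↑ˡ s) ≡ r (i ↑ˡ s)
    onPath i = begin
      r′ (i ↑ˡ s)              ≡⟨ sym (pad-toℕ (leafSum r′) (λ i → r′ (i ↑ˡ s)) i) ⟩
      profile r′ (suc (toℕ i)) ≡⟨ goodStructure-profile-unique good good′ (suc (toℕ i)) (s≤s (<⇒≤ (toℕ<n i))) ⟩
      profile r (suc (toℕ i))  ≡⟨ pad-toℕ (leafSum r) (λ i → r (i ↑ˡ s)) i ⟩
      r (i ↑ˡ s)               ∎
      where open ≡-Reasoning
    r′≗r : ∀ v → r′ v ≡ r v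
    r′≗r = ↑-elim (λ v → r′ v ≡ r v) onPath (λ j → trans (r′-leaf j) (sym (r-leaf j)))

  fromProfile : (ℕ → ℕ) → Fin (p + s) → ℕ
  fromProfile ρ v = [ (λ i → ρ (suc (toℕ i))) , a ]′ (splitAt p v)

  module _ (0<a : ∀ i → 0 < a i) (a∣c : ∀ i → a i ∣ c) (a<c : ∀ i → a i < c)
           (0<S : 0 < sum (tabulate a)) (coprime : gcdList (c ∷ map a (allFin s)) ≡ 1) where

    module _ {ρ} (chain : IsSmoothChain p ρ) (ρ[p]≡c : ρ p ≡ c) (ρ[1+p]≡S : ρ (suc p) ≡ sum (tabulate a)) where
      open IsSmoothChain chain
      private
        r = fromProfile ρ
        NS = neighbourSum (coconutTree p s) r

        r-path : ∀ i → r (i ↑ˡ s) ≡ ρ (suc (toℕ i))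
        r-path i = cong [ (λ i → ρ (suc (toℕ i))) , a ]′ (splitAt-↑ˡ p i s)

        r-leaf : ∀ j → r (p ↑ʳ j) ≡ a j
        r-leaf j = cong [ (λ i → ρ (suc (toℕ i))) , a ]′ (splitAt-↑ʳ p s j)

        r-top : ∀ v → toℕ v ≡ q → r v ≡ c
        r-top = ↑-elim (λ v → toℕ v ≡ q → r v ≡ c)
          (λ i m≡q → trans (r-path i) (trans (cong (ρ ∘ suc) (trans (sym (toℕ-↑ˡ i s)) m≡q)) ρ[p]≡c))
          (λ j p+j≡q → contradiction p+j≡q (>⇒≢ (subst (p ≤_) (sym (toℕ-↑ʳ p j)) (m≤m+n p (toℕ j)))))

        profile≗ρ : ∀ k → k ≤ suc p → profile r k ≡ ρ k
        profile≗ρ zero    _         = sym start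
        profile≗ρ (suc k) (s≤s k≤p) =
          pad-agrees ρ r-path (trans (cong sum (tabulate-cong r-leaf)) (sym ρ[1+p]≡S)) k k≤p

        Admissible : Fin (p + s) → Set
        Admissible v = 0 < r v × r v ∣ NS v × 0 < NS v × (toℕ v ≢ q → r v < NS v)

        path-admissible : ∀ m → m < p →
          0 < ρ (suc m) × ρ (suc m) ∣ ρ m + ρ (2 + m) × 0 < ρ m + ρ (2 + m) × (m ≢ q → ρ (suc m) < ρ m + ρ (2 + m))
        path-admissible m m<p with m≤n⇒m<n∨m≡n (s≤s⁻¹ m<p)
        ... | inj₁ m<q  = positive m m<p , balanced m m<p , ≤-<-trans z≤n steep , λ _ → steep
          where steep = smooth m (s≤s m<q)
        ... | inj₂ refl = positive q m<p , balanced q m<p , <-≤-trans (subst (0 <_) (sym ρ[1+p]≡S) 0<S) (m≤n+m _ _)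
                        , λ q≢q → contradiction refl q≢q

        admissible : ∀ v → Admissible v
        admissible = ↑-elim Admissible onPath onLeaf
          where
          onPath : ∀ i → Admissible (i ↑ˡ s)
          onPath i
            rewrite r-path i | neighbourSum-path r i
                  | profile≗ρ (toℕ i) (≤-trans (<⇒≤ (toℕ<n i)) (n≤1+n p)) | profile≗ρ (2 + toℕ i) (s≤s (toℕ<n i))
                  | toℕ-↑ˡ i s = path-admissible (toℕ i) (toℕ<n i)
          onLeaf : ∀ j → Admissible (p ↑ʳ j)
          onLeaf j rewrite r-leaf j | neighbourSum-leaf r j | profile≗ρ p (n≤1+n p) | ρ[p]≡c =
            0<a j , a∣c j , ≤-<-trans z≤n (a<c j) , λ _ → a<c j

        d : Fin (p + s) → ℕ
        d v = let _ , r∣NS , _ = admissible v in quotient r∣NS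

        arith : IsArithmetical (coconutTree p s) d r
        arith = record
          { d-pos   = λ v → let _ , r∣NS , 0<NS , _ = admissible v
                            in >-nonZero⁻¹ _ {{quotient≢0 r∣NS {{>-nonZero 0<NS}}}}
          ; r-pos   = λ v → let 0<r , _ = admissible v in 0<r
          ; balance = λ v → let _ , r∣NS , _ = admissible v in sym (m∣n⇒n≡quotient*m r∣NS)
          ; r-gcd   = ∣1⇒≡1 (subst (g ∣_) coprime (∣-gcdList _ (g∣c ∷ map⁺ (tabulate⁺ g∣a))))
          }
          where
          g = gcdList (map r (allFin (p + s)))
          g∣c : g ∣ c
          g∣c = subst (g ∣_) (r-top top toℕ-top) (∣-gcdList-allFin r top)
          g∣a : ∀ j → g ∣ a j
          g∣a j = subst (g ∣_) (r-leaf j) (∣-gcdList-allFin r (p ↑ʳ j))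

        smooth′ : IsSmooth p s d
        smooth′ v v≢q = let _ , r∣NS , _ , steep = admissible v in quotient>1 r∣NS (steep v≢q)

      chain⇒goodStructure : ∃₂ λ d r → GoodStructure s c a p d r
      chain⇒goodStructure = d , r , arith , smooth′ , r-leaf , r-top

    goodStructure-exists : FirstZero (descent (sum (tabulate a)) c ∘ suc) p → ∃₂ λ d r → GoodStructure s c a p d r
    goodStructure-exists firstZero =
      let chain , ρ[p]≡c , ρ[1+p]≡S = firstZero⇒chain firstZero
      in chain⇒goodStructure chain ρ[p]≡c ρ[1+p]≡S

sum-tabulate-positive : ∀ {s} (a : Fin s → ℕ) → 1 ≤ s → (∀ i → 0 < a i) → 0 < sum (tabulate a)
sum-tabulate-positive {suc s} a _ 0<a = ≤-trans (0<a fzero) (m≤m+n _ _)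

proposition4p18 :
    (s : ℕ) → 1 ≤ s → (c : ℕ) → (a : Fin s → ℕ) →
    1 ≤ c → (∀ i → 1 ≤ a i) →
    gcdList (c ∷ map a (allFin s)) ≡ 1 →
    (∀ i → a i ∣ c) → (∀ i → a i < c) →
    Σ ℕ (λ p → 1 ≤ p ×
      Σ (Fin (p + s) → ℕ) (λ d → Σ (Fin (p + s) → ℕ) (λ r →
        GoodStructure s c a p d r
        × (∀ d' r' → GoodStructure s c a p d' r' → ∀ v → d' v ≡ d v × r' v ≡ r v)))
      × (∀ p' → 1 ≤ p' → (d' r' : Fin (p' + s) → ℕ) →
           GoodStructure s c a p' d' r' → p' ≡ p))
proposition4p18 s 1≤s c a 0<c 0<a coprime a∣c a<c
  with firstZero-exists (descent (sum (tabulate a)) c ∘ suc) (descent-decreasing (sum (tabulate a)) c)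
... | zero  , c≡0 , _ = contradiction c≡0 (>⇒≢ 0<c)
... | suc q , firstZero =
  let d , r , good = goodStructure-exists 0<a a∣c a<c (sum-tabulate-positive a 1≤s 0<a) coprime firstZero
  in suc q , s≤s z≤n , (d , r , good , λ _ _ → goodStructure-unique good)
   , λ where (suc q′) _ _ _ good′ → firstZero-unique (CoconutStructures.goodStructure-length c a q′ good′) firstZero
  where open CoconutStructures c a q
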